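{- Let $\Gamma$ be a countable (undirected) graph. Then there exist $2^{\aleph_0}$ pairwise non-isomorphic countable algebraically closed directed graphs whose automorphism group is isomorphic to $\operatorname{Aut}\Gamma$.
   Context: A graph is a pair $(V,E)$ with $E$ an irreflexive symmetric binary relation on the non-empty set $V$. A directed graph is a pair $(V,E)$ with $E$ an irreflexive binary relation on the non-empty set $V$. A directed graph $(V,E)$ is algebraically closed if for every finite set $A\subseteq V$ there is a vertex $v$ with $(u,v)\in E$ and $(v,u)\in E$ for all $u\in A$. -}

module Defs where

open import Level using (0ℓ)
open import Data.Nat using (ℕ)
open import Data.Bool using (Bool)
open import Data.Product using (Σ; ∃; _×_; _,_; proj₁; proj₂)
open import Data.List using (List)
open import Data.List.Relation.Unary.All using (All)
open import Relation.Nullary using (¬_)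
open import Relation.Binary.PropositionalEquality
  using (_≡_; refl; sym; trans; cong)
open import Function.Definitions using (Injective)
open import Algebra.Bundles using (Group)
open import Algebra.Morphism.Structures using (module GroupMorphisms)

record Graph : Set₁ where
  field
    V        : Set
    E        : V → V → Set
    nonempty : V
    irrefl   : ∀ x → ¬ E x x
    symm     : ∀ {x y} → E x y → E y x

record Digraph : Set₁ where
  field
    V        : Set
    E        : V → V → Set
    nonempty : V
    irrefl   : ∀ x → ¬ E x x

Countable : Set → Set
Countable A = Σ (A → ℕ) (λ f → Injective _≡_ _≡_ f)

AlgebraicallyClosed : Digraph → Set
AlgebraicallyClosed D =
  (A : List V) → ∃ λ v → All (λ u → E u v × E v u) A
  where open Digraph D

record Iso {V₁ V₂ : Set} (E₁ : V₁ → V₁ → Set) (E₂ : V₂ → V₂ → Set) : Set where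
  field
    to       : V₁ → V₂
    from     : V₂ → V₁
    from∘to  : ∀ x → from (to x) ≡ x
    to∘from  : ∀ y → to (from y) ≡ y
    preserve : ∀ x y → E₁ x y → E₂ (to x) (to y)
    reflect  : ∀ x y → E₂ (to x) (to y) → E₁ x y

open Iso

_≅ᴰ_ : Digraph → Digraph → Set
D₁ ≅ᴰ D₂ = Iso (Digraph.E D₁) (Digraph.E D₂)

module _ {V : Set} (E : V → V → Set) where

  Aut : Set
  Aut = Iso E E

  _≈ᴬ_ : Aut → Aut → Set
  σ ≈ᴬ τ = ∀ x → to σ x ≡ to τ x

  _∙ᴬ_ : Aut → Aut → Aut
  σ ∙ᴬ τ = record
    { to       = λ x → to σ (to τ x)
    ; from     = λ y → from τ (from σ y)
    ; from∘to  = λ x → trans (cong (from τ) (from∘to σ (to τ x))) (from∘to τ x)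
    ; to∘from  = λ y → trans (cong (to σ) (to∘from τ (from σ y))) (to∘from σ y)
    ; preserve = λ x y e → preserve σ _ _ (preserve τ x y e)
    ; reflect  = λ x y e → reflect τ x y (reflect σ _ _ e)
    }

  idᴬ : Aut
  idᴬ = record
    { to = λ x → x ; from = λ x → x
    ; from∘to = λ _ → refl ; to∘from = λ _ → refl
    ; preserve = λ _ _ e → e ; reflect = λ _ _ e → e }

  invᴬ : Aut → Aut
  invᴬ σ = record
    { to       = from σ
    ; from     = to σ
    ; from∘to  = to∘from σ
    ; to∘from  = from∘to σ
    ; preserve = λ x y e → reflect σ (from σ x) (from σ y)
        (subst2 (to∘from σ x) (to∘from σ y) e)
    ; reflect  = λ x y e → subst2' (to∘from σ x) (to∘from σ y)
        (preserve σ (from σ x) (from σ y) e)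
    }
    where
    subst2 : ∀ {a a' b b'} → a' ≡ a → b' ≡ b → E a b → E a' b'
    subst2 refl refl e = e
    subst2' : ∀ {a a' b b'} → a ≡ a' → b ≡ b' → E a b → E a' b'
    subst2' refl refl e = e

  AutGroup : Group 0ℓ 0ℓ
  AutGroup = record
    { Carrier = Aut
    ; _≈_ = _≈ᴬ_
    ; _∙_ = _∙ᴬ_
    ; ε = idᴬ
    ; _⁻¹ = invᴬ
    ; isGroup = record
      { isMonoid = record
        { isSemigroup = record
          { isMagma = record
            { isEquivalence = record
              { refl = λ _ → refl
              ; sym = λ p x → sym (p x)
              ; trans = λ p q x → trans (p x) (q x) }
            ; ∙-cong = λ {σ} {σ'} {τ} {τ'} p q x →
                trans (cong (to σ) (q x)) (p (to τ' x)) }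
          ; assoc = λ _ _ _ _ → refl }
        ; identity = (λ _ _ → refl) , (λ _ _ → refl) }
      ; inverse = (λ σ x → from∘to σ x) , (λ σ x → to∘from σ x)
      ; ⁻¹-cong = λ {σ} {τ} p x →
          trans (sym (from∘to τ (from σ x)))
            (trans (cong (from τ) (sym (p (from σ x))))
                   (cong (from τ) (to∘from σ x))) }
    }

_≃ᴳ_ : Group 0ℓ 0ℓ → Group 0ℓ 0ℓ → Set
G ≃ᴳ H = Σ (Group.Carrier G → Group.Carrier H)
  (GroupMorphisms.IsGroupIsomorphism (Group.rawGroup G) (Group.rawGroup H))

-- Join Γ completely, in both directions, to a digraph Chain α on ℕ whose only one-way edges
-- are n → n + 1, whose pairs at distance 2 are joined both ways exactly when α n holds, and
-- whose pairs at distance at least 3 are always joined both ways.  Since Γ is symmetric, the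
-- one-way edges of the join form the ray 0 → 1 → 2 → ⋯; an isomorphism preserves them and
-- so fixes the ray pointwise, starting from its origin 0, the only vertex without an incoming
-- one-way edge.  Hence isomorphic joins have equal α, and every automorphism is an
-- automorphism of Γ extended by the identity.  The distance-3 edges give common neighbours.
module Submission where

open import Defs
open import Data.Nat using (ℕ)
open import Data.Bool using (Bool)
open import Data.Product using (Σ; _×_)
open import Relation.Nullary using (¬_)
open import Relation.Binary.PropositionalEquality using (_≡_)

open import Data.Nat using (zero; suc; _+_; _*_; _≤_; s≤s)
open import Data.Nat.Properties using (m+n≮n; even≢odd; *-cancelˡ-≡; suc-injective; +-monoʳ-≤)
open import Data.Bool using (true)
open import Data.Bool.Properties using (⇔→≡)
open import Data.Sum using (_⊎_; inj₁; inj₂)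
import Data.Sum as Sum
open import Data.Sum.Properties using (inj₁-injective)
open import Data.Unit using (⊤; tt)
open import Data.Empty using (⊥-elim)
open import Data.Product using (∃; _,_; proj₁; proj₂)
open import Data.List using (List; []; _∷_; partitionSums)
open import Data.List.Relation.Unary.All as All using (All; []; _∷_)
open import Data.List.Extrema.Nat using (max; xs≤max)
open import Function using (id)
open import Function.Bundles using (_⇔_; mk⇔)
import Function.Properties.Equivalence as ⇔
open import Function.Definitions using (Injective)
open import Relation.Nullary using (contradiction)
open import Relation.Binary.Definitions using (Symmetric)
open import Relation.Binary.PropositionalEquality using (refl; sym; trans; cong; subst; subst₂)
open Iso

⊎-countable : {A B : Set} → Countable A → Countable B → Countable (A ⊎ B)
⊎-countable {A} {B} (f , f-inj) (g , g-inj) = encode , encode-injective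
  where
  encode : A ⊎ B → ℕ
  encode (inj₁ a) = 2 * f a
  encode (inj₂ b) = suc (2 * g b)

  encode-injective : Injective _≡_ _≡_ encode
  encode-injective {inj₁ a} {inj₁ a'} e = cong inj₁ (f-inj (*-cancelˡ-≡ (f a) (f a') 2 e))
  encode-injective {inj₁ a} {inj₂ b} e = contradiction e (even≢odd (f a) (g b))
  encode-injective {inj₂ b} {inj₁ a} e = contradiction (sym e) (even≢odd (f a) (g b))
  encode-injective {inj₂ b} {inj₂ b'} e =
    cong inj₂ (g-inj (*-cancelˡ-≡ (g b) (g b') 2 (suc-injective e)))

ℕ-countable : Countable ℕ
ℕ-countable = id , id

OneWay : {V : Set} → (V → V → Set) → V → V → Set
OneWay E x y = E x y × ¬ E y x

BothWays : {V : Set} → (V → V → Set) → V → V → Set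
BothWays E v u = E u v × E v u

HasCommonNeighbours : {V : Set} → (V → V → Set) → Set
HasCommonNeighbours {V} E = (xs : List V) → ∃ λ v → All (BothWays E v) xs

module _ {V₁ V₂ : Set} {E₁ : V₁ → V₁ → Set} {E₂ : V₂ → V₂ → Set} (τ : Iso E₁ E₂) where

  to-injective : Injective _≡_ _≡_ (to τ)
  to-injective {x} {y} e = trans (sym (from∘to τ x)) (trans (cong (from τ) e) (from∘to τ y))

  Iso-sym : Iso E₂ E₁
  Iso-sym = record
    { to       = from τ
    ; from     = to τ
    ; from∘to  = to∘from τ
    ; to∘from  = from∘to τ
    ; preserve = λ x y e → reflect τ _ _ (subst₂ E₂ (sym (to∘from τ x)) (sym (to∘from τ y)) e)
    ; reflect  = λ x y e → subst₂ E₂ (to∘from τ x) (to∘from τ y) (preserve τ _ _ e)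
    }

  preserve-OneWay : ∀ {x y} → OneWay E₁ x y → OneWay E₂ (to τ x) (to τ y)
  preserve-OneWay (e , ¬e) = preserve τ _ _ e , λ e' → ¬e (reflect τ _ _ e')

fixed-edge⇔ : {V : Set} {E₁ E₂ : V → V → Set} (τ : Iso E₁ E₂) {x y : V} →
  to τ x ≡ x → to τ y ≡ y → E₁ x y ⇔ E₂ x y
fixed-edge⇔ {E₂ = E₂} τ τx≡x τy≡y = mk⇔
  (λ e → subst₂ E₂ τx≡x τy≡y (preserve τ _ _ e))
  (λ e → reflect τ _ _ (subst₂ E₂ (sym τx≡x) (sym τy≡y) e))

Join : {A B : Set} → (A → A → Set) → (B → B → Set) → A ⊎ B → A ⊎ B → Set
Join E F (inj₁ a) (inj₁ a') = E a a'
Join E F (inj₂ b) (inj₂ b') = F b b'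
Join E F _        _         = ⊤

module _ {A B : Set} {E : A → A → Set} {F : B → B → Set} where

  Join-irrefl : (∀ a → ¬ E a a) → (∀ b → ¬ F b b) → ∀ x → ¬ Join E F x x
  Join-irrefl E-irrefl F-irrefl (inj₁ a) = E-irrefl a
  Join-irrefl E-irrefl F-irrefl (inj₂ b) = F-irrefl b

  All-BothWays-Join : ∀ {b} xs → All (BothWays F b) (proj₂ (partitionSums xs)) →
    All (BothWays (Join E F) (inj₂ b)) xs
  All-BothWays-Join []             []           = []
  All-BothWays-Join (inj₁ _ ∷ xs) adjs         = (tt , tt) ∷ All-BothWays-Join xs adjs
  All-BothWays-Join (inj₂ _ ∷ xs) (adj ∷ adjs) = adj ∷ All-BothWays-Join xs adjs

  Join-hasCommonNeighbours : HasCommonNeighbours F → HasCommonNeighbours (Join E F)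
  Join-hasCommonNeighbours F-closed xs with F-closed (proj₂ (partitionSums xs))
  ... | b , adjs = inj₂ b , All-BothWays-Join xs adjs

  Join-oneWay : Symmetric E → ∀ {x y} → OneWay (Join E F) x y →
    ∃ λ b → ∃ λ b' → x ≡ inj₂ b × y ≡ inj₂ b' × OneWay F b b'
  Join-oneWay E-sym {inj₁ _} {inj₁ _} (e , ¬e) = contradiction (E-sym e) ¬e
  Join-oneWay E-sym {inj₁ _} {inj₂ _} (_ , ¬e) = contradiction tt ¬e
  Join-oneWay E-sym {inj₂ _} {inj₁ _} (_ , ¬e) = contradiction tt ¬e
  Join-oneWay E-sym {inj₂ b} {inj₂ b'} ow      = b , b' , refl , refl , ow

fixes-inj₂⇒preserves-inj₁ : {A B : Set} {h : A ⊎ B → A ⊎ B} → Injective _≡_ _≡_ h →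
  (∀ b → h (inj₂ b) ≡ inj₂ b) → ∀ a → ∃ λ a' → h (inj₁ a) ≡ inj₁ a'
fixes-inj₂⇒preserves-inj₁ {h = h} h-inj h-fix a with h (inj₁ a) in eq
... | inj₁ a' = a' , refl
... | inj₂ b  = contradiction (h-inj (trans eq (sym (h-fix b)))) λ ()

module JoinAutomorphisms {A B : Set} {E : A → A → Set} {F : B → B → Set}
  (rigid : (σ : Aut (Join E F)) → ∀ b → to σ (inj₂ b) ≡ inj₂ b) where

  restrictMap : Aut (Join E F) → A → A
  restrictMap σ a = proj₁ (fixes-inj₂⇒preserves-inj₁ (to-injective σ) (rigid σ) a)

  restrictMap-correct : ∀ σ a → to σ (inj₁ a) ≡ inj₁ (restrictMap σ a)
  restrictMap-correct σ a = proj₂ (fixes-inj₂⇒preserves-inj₁ (to-injective σ) (rigid σ) a)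

  restrictMap-unique : ∀ σ {a a'} → to σ (inj₁ a) ≡ inj₁ a' → restrictMap σ a ≡ a'
  restrictMap-unique σ e = inj₁-injective (trans (sym (restrictMap-correct σ _)) e)

  restrict : Aut (Join E F) → Aut E
  restrict σ = record
    { to       = restrictMap σ
    ; from     = restrictMap σ⁻¹
    ; from∘to  = λ a → restrictMap-unique σ⁻¹
        (trans (cong (from σ) (sym (restrictMap-correct σ a))) (from∘to σ (inj₁ a)))
    ; to∘from  = λ a → restrictMap-unique σ
        (trans (cong (to σ) (sym (restrictMap-correct σ⁻¹ a))) (to∘from σ (inj₁ a)))
    ; preserve = λ a a' e →
        subst₂ (Join E F) (restrictMap-correct σ a) (restrictMap-correct σ a') (preserve σ _ _ e)
    ; reflect  = λ a a' e → reflect σ _ _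
        (subst₂ (Join E F) (sym (restrictMap-correct σ a)) (sym (restrictMap-correct σ a')) e)
    }
    where
    σ⁻¹ : Aut (Join E F)
    σ⁻¹ = invᴬ (Join E F) σ

  extend : Aut E → Aut (Join E F)
  extend ρ = record
    { to       = extended
    ; from     = Sum.map (from ρ) id
    ; from∘to  = λ { (inj₁ a) → cong inj₁ (from∘to ρ a) ; (inj₂ _) → refl }
    ; to∘from  = λ { (inj₁ a) → cong inj₁ (to∘from ρ a) ; (inj₂ _) → refl }
    ; preserve = preserve-extended
    ; reflect  = reflect-extended
    }
    where
    extended : A ⊎ B → A ⊎ B
    extended = Sum.map (to ρ) id

    preserve-extended : ∀ x y → Join E F x y → Join E F (extended x) (extended y)
    preserve-extended (inj₁ a) (inj₁ a') e = preserve ρ a a' e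
    preserve-extended (inj₁ _) (inj₂ _)  _ = tt
    preserve-extended (inj₂ _) (inj₁ _)  _ = tt
    preserve-extended (inj₂ _) (inj₂ _)  e = e

    reflect-extended : ∀ x y → Join E F (extended x) (extended y) → Join E F x y
    reflect-extended (inj₁ a) (inj₁ a') e = reflect ρ a a' e
    reflect-extended (inj₁ _) (inj₂ _)  _ = tt
    reflect-extended (inj₂ _) (inj₁ _)  _ = tt
    reflect-extended (inj₂ _) (inj₂ _)  e = e

  restrict-injective : ∀ σ τ → _≈ᴬ_ E (restrict σ) (restrict τ) → _≈ᴬ_ (Join E F) σ τ
  restrict-injective σ τ p (inj₁ a) =
    trans (restrictMap-correct σ a) (trans (cong inj₁ (p a)) (sym (restrictMap-correct τ a)))
  restrict-injective σ τ p (inj₂ b) = trans (rigid σ b) (sym (rigid τ b))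

  Aut-Join≃Aut : AutGroup (Join E F) ≃ᴳ AutGroup E
  Aut-Join≃Aut = restrict , record
    { isGroupMonomorphism = record
      { isGroupHomomorphism = record
        { isMonoidHomomorphism = record
          { isMagmaHomomorphism = record
            { isRelHomomorphism = record
              { cong = λ {σ} {τ} p a →
                  restrictMap-unique σ (trans (p (inj₁ a)) (restrictMap-correct τ a)) }
            ; homo = λ σ τ a → restrictMap-unique (_∙ᴬ_ (Join E F) σ τ)
                (trans (cong (to σ) (restrictMap-correct τ a)) (restrictMap-correct σ _)) }
          ; ε-homo = λ a → restrictMap-unique (idᴬ (Join E F)) refl }
        ; ⁻¹-homo = λ σ a → refl }
      ; injective = λ {σ} {τ} → restrict-injective σ τ }
    ; surjective = λ ρ → extend ρ , λ {σ} p a → restrictMap-unique σ (p (inj₁ a)) }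

data Chain (α : ℕ → Bool) : ℕ → ℕ → Set where
  step  : ∀ {m} → Chain α m (suc m)
  skip  : ∀ {m} → α m ≡ true → Chain α m (suc (suc m))
  skip⁻ : ∀ {n} → α n ≡ true → Chain α (suc (suc n)) n
  far   : ∀ {m n} → 3 + m ≤ n → Chain α m n
  far⁻  : ∀ {m n} → 3 + n ≤ m → Chain α m n

module _ {α : ℕ → Bool} where

  Chain-irrefl : ∀ n → ¬ Chain α n n
  Chain-irrefl n (far l)  = m+n≮n 2 n l
  Chain-irrefl n (far⁻ l) = m+n≮n 2 n l

  Chain-step-oneWay : ∀ {m} → OneWay (Chain α) m (suc m)
  Chain-step-oneWay {m} = step , λ where
    (far l)        → m+n≮n 3 m l
    (far⁻ (s≤s l)) → m+n≮n 1 m l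

  Chain-oneWay⇒step : ∀ {m n} → OneWay (Chain α) m n → n ≡ suc m
  Chain-oneWay⇒step (step , _)      = refl
  Chain-oneWay⇒step (skip p , ¬e)  = contradiction (skip⁻ p) ¬e
  Chain-oneWay⇒step (skip⁻ p , ¬e) = contradiction (skip p) ¬e
  Chain-oneWay⇒step (far l , ¬e)   = contradiction (far⁻ l) ¬e
  Chain-oneWay⇒step (far⁻ l , ¬e)  = contradiction (far l) ¬e

  Chain-skip⇔ : ∀ {m} → Chain α m (suc (suc m)) ⇔ α m ≡ true
  Chain-skip⇔ {m} = mk⇔ skip⇒α skip
    where
    skip⇒α : Chain α m (suc (suc m)) → α m ≡ true
    skip⇒α (skip p)            = p
    skip⇒α (far (s≤s (s≤s l))) = contradiction l (m+n≮n 0 m)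
    skip⇒α (far⁻ l)            = contradiction l (m+n≮n 4 m)

  Chain-hasCommonNeighbours : HasCommonNeighbours (Chain α)
  Chain-hasCommonNeighbours ns = 3 + max 0 ns , All.map adjacent (xs≤max 0 ns)
    where
    adjacent : ∀ {m} → m ≤ max 0 ns → BothWays (Chain α) (3 + max 0 ns) m
    adjacent m≤ = far (+-monoʳ-≤ 3 m≤) , far⁻ (+-monoʳ-≤ 3 m≤)

module _ {A : Set} {E : A → A → Set} (E-sym : Symmetric E) where

  oneWay⇒ray : ∀ {γ x y} → OneWay (Join E (Chain γ)) x y →
    ∃ λ k → x ≡ inj₂ k × y ≡ inj₂ (suc k)
  oneWay⇒ray ow with Join-oneWay E-sym ow
  ... | b , _ , x≡b , y≡b' , ow' = b , x≡b , trans y≡b' (cong inj₂ (Chain-oneWay⇒step ow'))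

  no-oneWay-into-origin : ∀ {γ x} → ¬ OneWay (Join E (Chain γ)) x (inj₂ 0)
  no-oneWay-into-origin {γ} {x} ow with oneWay⇒ray {γ} {x} {inj₂ 0} ow
  ... | _ , _ , ()

  ray-fixed : ∀ {α β} (τ : Iso (Join E (Chain α)) (Join E (Chain β))) →
    ∀ n → to τ (inj₂ n) ≡ inj₂ n
  ray-fixed {α} {β} τ zero
    with oneWay⇒ray {β} {to τ (inj₂ 0)} {to τ (inj₂ 1)} (preserve-OneWay τ Chain-step-oneWay)
  ... | zero  , τ0≡0   , _ = τ0≡0
  ... | suc i , τ0≡1+i , _ = ⊥-elim (no-oneWay-into-origin {α} {from τ (inj₂ i)}
        (subst (OneWay (Join E (Chain α)) (from τ (inj₂ i))) from-1+i≡0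
          (preserve-OneWay (Iso-sym τ) Chain-step-oneWay)))
    where
    from-1+i≡0 : from τ (inj₂ (suc i)) ≡ inj₂ 0
    from-1+i≡0 = trans (cong (from τ) (sym τ0≡1+i)) (from∘to τ (inj₂ 0))
  ray-fixed {β = β} τ (suc n)
    with oneWay⇒ray {x = inj₂ n}
      (subst (λ z → OneWay (Join E (Chain β)) z (to τ (inj₂ (suc n)))) (ray-fixed τ n)
        (preserve-OneWay τ Chain-step-oneWay))
  ... | _ , refl , τ[1+n]≡1+n = τ[1+n]≡1+n

  Join-Chain-iso⇒≗ : ∀ {α β} → Iso (Join E (Chain α)) (Join E (Chain β)) → ∀ k → α k ≡ β k
  Join-Chain-iso⇒≗ τ k = ⇔→≡ (⇔.trans (⇔.sym Chain-skip⇔)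
    (⇔.trans (fixed-edge⇔ τ (ray-fixed τ k) (ray-fixed τ (suc (suc k)))) Chain-skip⇔))

ChainJoin : Graph → (ℕ → Bool) → Digraph
ChainJoin Γ α = record
  { V        = Graph.V Γ ⊎ ℕ
  ; E        = Join (Graph.E Γ) (Chain α)
  ; nonempty = inj₂ 0
  ; irrefl   = Join-irrefl (Graph.irrefl Γ) Chain-irrefl
  }

theorem4p3 : (Γ : Graph) → Countable (Graph.V Γ) →
    Σ ((ℕ → Bool) → Digraph) λ D →
      ((α : ℕ → Bool) →
          Countable (Digraph.V (D α))
        × AlgebraicallyClosed (D α)
        × (AutGroup (Digraph.E (D α)) ≃ᴳ AutGroup (Graph.E Γ)))
      × ((α β : ℕ → Bool) → ¬ (∀ n → α n ≡ β n) → ¬ (D α ≅ᴰ D β))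
theorem4p3 Γ Γ-countable = ChainJoin Γ , properties , non-isomorphic
  where
  properties : (α : ℕ → Bool) →
      Countable (Graph.V Γ ⊎ ℕ)
    × AlgebraicallyClosed (ChainJoin Γ α)
    × (AutGroup (Join (Graph.E Γ) (Chain α)) ≃ᴳ AutGroup (Graph.E Γ))
  properties α =
      ⊎-countable Γ-countable ℕ-countable
    , Join-hasCommonNeighbours Chain-hasCommonNeighbours
    , JoinAutomorphisms.Aut-Join≃Aut (ray-fixed (Graph.symm Γ))

  non-isomorphic : ∀ α β → ¬ (∀ n → α n ≡ β n) → ¬ (ChainJoin Γ α ≅ᴰ ChainJoin Γ β)
  non-isomorphic α β α≢β τ = α≢β (Join-Chain-iso⇒≗ (Graph.symm Γ) τ)
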